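{- Let $A,B,C\subset\mathbb{R}^d$ be pairwise disjoint finite nonempty sets with $|A|\le|B|$ (or, for weighted sets with positive weights $w$, with $w(A)\le w(B)$, all quantities taken in their weighted versions). Then $\Delta(A\cup B\cup C)\le\Delta(A)+3\Delta(B\cup C)+4D(A,B)$ and $D(A\cup B,C)\le 3\Delta(B\cup C)+3D(A,B)-\Delta(B)-\Delta(C)$.
   Context: For finite nonempty $Q$, $\mu(Q)$ is the centroid and $\Delta(Q)=\sum_{q\in Q}\|q-\mu(Q)\|^2$; in the weighted case $w(Q)=\sum_{x\in Q}w(x)$, $\mu(Q)=\frac1{w(Q)}\sum_{x\in Q}w(x)x$ and $\Delta(Q)=\sum_{x\in Q}w(x)\|x-\mu(Q)\|^2$. For disjoint $A,B$, $D(A,B)=\Delta(A\cup B)-\Delta(A)-\Delta(B)$. -}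

module Defs where

open import Level using (Level; _⊔_) renaming (suc to lsuc)
open import Data.Nat using (ℕ)
open import Data.Fin using (Fin)
open import Data.Product using (_×_)
open import Data.List using (List; []; _∷_; map; foldr)
open import Data.List.Relation.Unary.Any using (Any)
open import Data.List.Relation.Unary.AllPairs using (AllPairs)
import Data.Vec.Functional as VF
open import Relation.Nullary using (¬_)
open import Relation.Binary.Structures using (IsTotalOrder)
open import Algebra.Bundles using (CommutativeRing)

-- An ordered field (contains ℝ as an instance).  The inverse is a total
-- function; its value at 0 is unconstrained and never used.
record OrderedField (c ℓ : Level) : Set (lsuc (c ⊔ ℓ)) where
  field
    commutativeRing : CommutativeRing c ℓ
  open CommutativeRing commutativeRing public
  infix 4 _≤_
  infix 8 _⁻¹
  field
    _≤_          : Carrier → Carrier → Set ℓ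
    isTotalOrder : IsTotalOrder _≈_ _≤_
    +-monoˡ-≤    : ∀ {a b} c → a ≤ b → a + c ≤ b + c
    *-nonneg     : ∀ {a b} → 0# ≤ a → 0# ≤ b → 0# ≤ a * b
    0≉1          : ¬ (0# ≈ 1#)
    _⁻¹          : Carrier → Carrier
    ⁻¹-inverse   : ∀ x → ¬ (x ≈ 0#) → x * (x ⁻¹) ≈ 1#

  infix 4 _<_
  _<_ : Carrier → Carrier → Set ℓ
  a < b = (a ≤ b) × ¬ (a ≈ b)

-- Euclidean geometry in F^d, with weighted finite point sets represented
-- as duplicate-free lists of points and a weight function w.
module Geometry {c ℓ : Level} (F : OrderedField c ℓ) where
  open OrderedField F

  Point : ℕ → Set c
  Point d = Fin d → Carrier

  _≋_ : ∀ {d} → Point d → Point d → Set ℓ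
  x ≋ y = ∀ i → x i ≈ y i

  _∈ₚ_ : ∀ {d} → Point d → List (Point d) → Set (c ⊔ ℓ)
  x ∈ₚ Q = Any (x ≋_) Q

  Distinct : ∀ {d} → List (Point d) → Set (c ⊔ ℓ)
  Distinct Q = AllPairs (λ x y → ¬ (x ≋ y)) Q

  Disjoint : ∀ {d} → List (Point d) → List (Point d) → Set (c ⊔ ℓ)
  Disjoint P Q = ∀ x → x ∈ₚ P → x ∈ₚ Q → Data.Empty.⊥
    where import Data.Empty

  sumL : List Carrier → Carrier
  sumL = foldr _+_ 0#

  _-ₚ_ : ∀ {d} → Point d → Point d → Point d
  (x -ₚ y) i = x i - y i

  ‖_‖² : ∀ {d} → Point d → Carrier
  ‖ x ‖² = VF.foldr _+_ 0# (λ i → x i * x i)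

  three four : Carrier
  three = 1# + 1# + 1#
  four  = 1# + 1# + 1# + 1#

  module Weighted {d : ℕ} (w : Point d → Carrier) where
    wt : List (Point d) → Carrier
    wt Q = sumL (map w Q)

    μ : List (Point d) → Point d
    μ Q i = (wt Q) ⁻¹ * sumL (map (λ x → w x * x i) Q)

    Δ : List (Point d) → Carrier
    Δ Q = sumL (map (λ x → w x * ‖ x -ₚ μ Q ‖²) Q)

    -- D(P,Q) = Δ(P ∪ Q) − Δ(P) − Δ(Q)   (P, Q disjoint, so ∪ is ++)
    D : List (Point d) → List (Point d) → Carrier
    D P Q = Δ (P Data.List.++ Q) - Δ P - Δ Q

module Submission where

-- Everything splits over coordinates, and in one coordinate merging clusters P
-- and Q costs D(P,Q) = w(P) w(Q) (μ(P) − μ(Q))² / (w(P) + w(Q)).  Since μ(B ∪ C)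
-- is the weighted mean of μ(B) and μ(C), this formula gives
-- D(A, B ∪ C) ≤ 2 D(B,C) + 4 D(A,B) as soon as w(A) ≤ w(B): cleared of
-- denominators, the gap is a sum of squares with nonnegative coefficients.
-- Both inequalities then follow linearly from this bound, from
-- Δ(P ∪ Q) = Δ(P) + Δ(Q) + D(P,Q) and from Δ(B), Δ(C) ≥ 0.

open import Defs
open import Level using (Level)
open import Data.Nat using (ℕ)
open import Data.List using (List; []; _++_)
open import Data.Product using (_×_)
open import Relation.Binary.PropositionalEquality using (_≢_)

open import Algebra.Bundles using (CommutativeRing)
open import Algebra.Solver.Ring.AlmostCommutativeRing
  using (fromCommutativeRing; _-Raw-AlmostCommutative⟶_)
open import Data.Empty using (⊥-elim)
open import Data.Fin.Base as Fin using (Fin)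
open import Data.Integer.Base as ℤ using (ℤ; +_; -[1+_]; _⊖_; _◃_; sign; ∣_∣)
import Data.Integer.Properties as ℤ
open import Data.List.Base using (_∷_; map)
open import Data.List.Properties using (++-assoc)
open import Data.List.Relation.Unary.Any using (here; there)
open import Data.List.Relation.Unary.Any.Properties using (++⁺ˡ; ++⁺ʳ)
open import Data.Maybe.Base using (Maybe; just; nothing)
open import Data.Nat.Base as ℕ using (zero; suc)
import Data.Nat.Properties as ℕ
open import Data.Product.Base using (_,_; proj₁)
open import Data.Sign.Base as Sign using (Sign)
open import Data.Sum.Base using (inj₁; inj₂)
open import Data.Vec.Functional using (Vector)
open import Function.Base using (_∘_)
open import Relation.Binary.Bundles using (Poset)
open import Relation.Binary.PropositionalEquality.Core using (cong) renaming (refl to ≡-refl; sym to ≡-sym)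
open import Relation.Binary.Structures using (IsTotalOrder)
open import Relation.Nullary.Decidable.Core using (yes; no)
open import Relation.Nullary.Negation.Core using (¬_)

import Relation.Binary.Reasoning.PartialOrder
import Relation.Binary.Reasoning.Setoid

-- The standard library's solvers for an arbitrary commutative ring take the ring
-- itself as coefficients and then cannot see that 1 − 1 = 0; integer
-- coefficients avoid this.
module IntegerCoefficientSolver {c ℓ} (R : CommutativeRing c ℓ) where
  open CommutativeRing R
  open import Algebra.Properties.Ring ring
    using (-0#≈0#; -‿involutive; -‿+-comm; ⁻¹-anti-homo‿-; xyx⁻¹≈y; -1*x≈-x)
  open import Algebra.Properties.CommutativeSemigroup *-commutativeSemigroup using (interchange)
  open import Algebra.Properties.Semiring.Mult.TCOptimised semiring
    using (×-homo-+; ×1-homo-*) renaming (_×_ to _×ᵣ_)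
  open import Relation.Binary.Reasoning.Setoid setoid

  ⟦_⟧ℕ : ℕ → Carrier
  ⟦ n ⟧ℕ = n ×ᵣ 1#

  ⟦_⟧ℤ : ℤ → Carrier
  ⟦ + n ⟧ℤ = ⟦ n ⟧ℕ
  ⟦ -[1+ n ] ⟧ℤ = - ⟦ suc n ⟧ℕ

  ⟦_⟧ₛ : Sign → Carrier
  ⟦ Sign.+ ⟧ₛ = 1#
  ⟦ Sign.- ⟧ₛ = - 1#

  ⟦⟧ℕ-homo-∸ : ∀ {m n} → n ℕ.≤ m → ⟦ m ℕ.∸ n ⟧ℕ ≈ ⟦ m ⟧ℕ - ⟦ n ⟧ℕ
  ⟦⟧ℕ-homo-∸ {m} {n} n≤m = begin
    ⟦ m ℕ.∸ n ⟧ℕ                     ≈⟨ xyx⁻¹≈y ⟦ n ⟧ℕ _ ⟨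
    ⟦ n ⟧ℕ + ⟦ m ℕ.∸ n ⟧ℕ - ⟦ n ⟧ℕ    ≈⟨ +-congʳ (×-homo-+ 1# n (m ℕ.∸ n)) ⟨
    ⟦ n ℕ.+ (m ℕ.∸ n) ⟧ℕ - ⟦ n ⟧ℕ     ≡⟨ cong (λ k → ⟦ k ⟧ℕ - ⟦ n ⟧ℕ) (ℕ.m+[n∸m]≡n n≤m) ⟩
    ⟦ m ⟧ℕ - ⟦ n ⟧ℕ                   ∎

  ⟦⟧ℤ-homo-neg : ∀ i → ⟦ ℤ.- i ⟧ℤ ≈ - ⟦ i ⟧ℤ
  ⟦⟧ℤ-homo-neg (+ zero)  = sym -0#≈0#
  ⟦⟧ℤ-homo-neg (+ suc n) = refl
  ⟦⟧ℤ-homo-neg -[1+ n ]  = sym (-‿involutive _)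

  ⟦⟧ℤ-homo-⊖ : ∀ m n → ⟦ m ⊖ n ⟧ℤ ≈ ⟦ m ⟧ℕ - ⟦ n ⟧ℕ
  ⟦⟧ℤ-homo-⊖ m n with ℕ.≤-total n m
  ... | inj₁ n≤m = trans (reflexive (cong ⟦_⟧ℤ (ℤ.⊖-≥ n≤m))) (⟦⟧ℕ-homo-∸ n≤m)
  ... | inj₂ m≤n = begin
    ⟦ m ⊖ n ⟧ℤ                ≡⟨ cong ⟦_⟧ℤ (ℤ.⊖-≤ m≤n) ⟩
    ⟦ ℤ.- + (n ℕ.∸ m) ⟧ℤ      ≈⟨ ⟦⟧ℤ-homo-neg (+ (n ℕ.∸ m)) ⟩
    - ⟦ n ℕ.∸ m ⟧ℕ             ≈⟨ -‿cong (⟦⟧ℕ-homo-∸ m≤n) ⟩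
    - (⟦ n ⟧ℕ - ⟦ m ⟧ℕ)        ≈⟨ ⁻¹-anti-homo‿- ⟦ n ⟧ℕ ⟦ m ⟧ℕ ⟩
    ⟦ m ⟧ℕ - ⟦ n ⟧ℕ            ∎

  ⟦⟧ℤ-homo-+ : ∀ i j → ⟦ i ℤ.+ j ⟧ℤ ≈ ⟦ i ⟧ℤ + ⟦ j ⟧ℤ
  ⟦⟧ℤ-homo-+ (+ m)     (+ n)     = ×-homo-+ 1# m n
  ⟦⟧ℤ-homo-+ (+ m)     -[1+ n ]  = ⟦⟧ℤ-homo-⊖ m (suc n)
  ⟦⟧ℤ-homo-+ -[1+ m ]  (+ n)     = trans (⟦⟧ℤ-homo-⊖ n (suc m)) (+-comm _ _)
  ⟦⟧ℤ-homo-+ -[1+ m ]  -[1+ n ]  = begin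
    - ⟦ suc (suc (m ℕ.+ n)) ⟧ℕ        ≡⟨ cong (λ k → - ⟦ suc k ⟧ℕ) (≡-sym (ℕ.+-suc m n)) ⟩
    - ⟦ suc m ℕ.+ suc n ⟧ℕ            ≈⟨ -‿cong (×-homo-+ 1# (suc m) (suc n)) ⟩
    - (⟦ suc m ⟧ℕ + ⟦ suc n ⟧ℕ)       ≈⟨ -‿+-comm _ _ ⟨
    - ⟦ suc m ⟧ℕ + - ⟦ suc n ⟧ℕ       ∎

  ⟦⟧ℤ-homo-◃ : ∀ s n → ⟦ s ◃ n ⟧ℤ ≈ ⟦ s ⟧ₛ * ⟦ n ⟧ℕ
  ⟦⟧ℤ-homo-◃ s      zero    = sym (zeroʳ _)
  ⟦⟧ℤ-homo-◃ Sign.+ (suc n) = sym (*-identityˡ _)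
  ⟦⟧ℤ-homo-◃ Sign.- (suc n) = sym (-1*x≈-x _)

  ⟦⟧ₛ-homo-* : ∀ s t → ⟦ s Sign.* t ⟧ₛ ≈ ⟦ s ⟧ₛ * ⟦ t ⟧ₛ
  ⟦⟧ₛ-homo-* Sign.+ t      = sym (*-identityˡ _)
  ⟦⟧ₛ-homo-* Sign.- Sign.+ = sym (*-identityʳ _)
  ⟦⟧ₛ-homo-* Sign.- Sign.- = sym (trans (-1*x≈-x _) (-‿involutive _))

  ⟦⟧ℤ-sign-abs : ∀ i → ⟦ i ⟧ℤ ≈ ⟦ sign i ⟧ₛ * ⟦ ∣ i ∣ ⟧ℕ
  ⟦⟧ℤ-sign-abs i =
    trans (reflexive (cong ⟦_⟧ℤ (≡-sym (ℤ.◃-inverse i)))) (⟦⟧ℤ-homo-◃ (sign i) ∣ i ∣)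

  ⟦⟧ℤ-homo-* : ∀ i j → ⟦ i ℤ.* j ⟧ℤ ≈ ⟦ i ⟧ℤ * ⟦ j ⟧ℤ
  ⟦⟧ℤ-homo-* i j = begin
    ⟦ i ℤ.* j ⟧ℤ
      ≈⟨ ⟦⟧ℤ-homo-◃ (sign i Sign.* sign j) (∣ i ∣ ℕ.* ∣ j ∣) ⟩
    ⟦ sign i Sign.* sign j ⟧ₛ * ⟦ ∣ i ∣ ℕ.* ∣ j ∣ ⟧ℕ
      ≈⟨ *-cong (⟦⟧ₛ-homo-* (sign i) (sign j)) (×1-homo-* ∣ i ∣ ∣ j ∣) ⟩
    (⟦ sign i ⟧ₛ * ⟦ sign j ⟧ₛ) * (⟦ ∣ i ∣ ⟧ℕ * ⟦ ∣ j ∣ ⟧ℕ)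
      ≈⟨ interchange _ _ _ _ ⟩
    (⟦ sign i ⟧ₛ * ⟦ ∣ i ∣ ⟧ℕ) * (⟦ sign j ⟧ₛ * ⟦ ∣ j ∣ ⟧ℕ)
      ≈⟨ *-cong (⟦⟧ℤ-sign-abs i) (⟦⟧ℤ-sign-abs j) ⟨
    ⟦ i ⟧ℤ * ⟦ j ⟧ℤ ∎

  ℤ⟶R : ℤ.+-*-rawRing -Raw-AlmostCommutative⟶ fromCommutativeRing R
  ℤ⟶R = record
    { ⟦_⟧    = ⟦_⟧ℤ
    ; +-homo = ⟦⟧ℤ-homo-+
    ; *-homo = ⟦⟧ℤ-homo-*
    ; -‿homo = ⟦⟧ℤ-homo-neg
    ; 0-homo = refl
    ; 1-homo = refl
    }

  ⟦⟧ℤ-equal? : ∀ i j → Maybe (⟦ i ⟧ℤ ≈ ⟦ j ⟧ℤ)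
  ⟦⟧ℤ-equal? i j with i ℤ.≟ j
  ... | yes i≡j = just (reflexive (cong ⟦_⟧ℤ i≡j))
  ... | no _    = nothing

  open import Algebra.Solver.Ring ℤ.+-*-rawRing (fromCommutativeRing R) ℤ⟶R ⟦⟧ℤ-equal? public
    using (solve; _:=_; con; _:+_; _:*_; _:-_; :-_)

module OrderedFieldProperties {c ℓ} (F : OrderedField c ℓ) where
  open OrderedField F
  open IntegerCoefficientSolver commutativeRing
  open import Algebra.Properties.Ring ring using (-1*x≈-x)
  open import Algebra.Properties.Semiring.Sum semiring using (sum; ∑-distrib-+; *-distribˡ-sum; sum-cong-≋)
  open IsTotalOrder isTotalOrder public using (total; antisym)
    renaming (refl to ≤-refl; trans to ≤-trans; reflexive to ≤-reflexive)

  poset : Poset c ℓ ℓ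
  poset = record { isPartialOrder = IsTotalOrder.isPartialOrder isTotalOrder }

  module ≤-Reasoning = Relation.Binary.Reasoning.PartialOrder poset
  module ≈-Reasoning = Relation.Binary.Reasoning.Setoid setoid

  two : Carrier
  two = 1# + 1#

  +-monoʳ-≤ : ∀ a {x y} → x ≤ y → a + x ≤ a + y
  +-monoʳ-≤ a {x} {y} x≤y = begin
    a + x  ≈⟨ +-comm a x ⟩
    x + a  ≤⟨ +-monoˡ-≤ a x≤y ⟩
    y + a  ≈⟨ +-comm y a ⟩
    a + y  ∎
    where open ≤-Reasoning

  +-mono-≤ : ∀ {x y u v} → x ≤ y → u ≤ v → x + u ≤ y + v
  +-mono-≤ {y = y} {u} x≤y u≤v = ≤-trans (+-monoˡ-≤ u x≤y) (+-monoʳ-≤ y u≤v)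

  x≤x+y : ∀ x {y} → 0# ≤ y → x ≤ x + y
  x≤x+y x {y} 0≤y = begin
    x       ≈⟨ +-identityʳ x ⟨
    x + 0#  ≤⟨ +-monoʳ-≤ x 0≤y ⟩
    x + y   ∎
    where open ≤-Reasoning

  nonNeg+nonNeg⇒nonNeg : ∀ {x y} → 0# ≤ x → 0# ≤ y → 0# ≤ x + y
  nonNeg+nonNeg⇒nonNeg {x} 0≤x 0≤y = ≤-trans 0≤x (x≤x+y x 0≤y)

  x≤y⇒0≤y-x : ∀ {x y} → x ≤ y → 0# ≤ y - x
  x≤y⇒0≤y-x {x} {y} x≤y = begin
    0#     ≈⟨ -‿inverseʳ x ⟨
    x - x  ≤⟨ +-monoˡ-≤ (- x) x≤y ⟩
    y - x  ∎
    where open ≤-Reasoning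

  0≤y-x⇒x≤y : ∀ {x y} → 0# ≤ y - x → x ≤ y
  0≤y-x⇒x≤y {x} {y} 0≤y-x = begin
    x          ≈⟨ +-identityˡ x ⟨
    0# + x     ≤⟨ +-monoˡ-≤ x 0≤y-x ⟩
    y - x + x  ≈⟨ solve 2 (λ x y → y :- x :+ x := y) refl x y ⟩
    y          ∎
    where open ≤-Reasoning

  0≤x*x : ∀ x → 0# ≤ x * x
  0≤x*x x with total 0# x
  ... | inj₁ 0≤x = *-nonneg 0≤x 0≤x
  ... | inj₂ x≤0 = begin
    0#         ≤⟨ *-nonneg 0≤-x 0≤-x ⟩
    - x * - x  ≈⟨ solve 1 (λ x → :- x :* :- x := x :* x) refl x ⟩
    x * x      ∎
    where
    open ≤-Reasoning
    0≤-x : 0# ≤ - x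
    0≤-x = ≤-trans (x≤y⇒0≤y-x x≤0) (≤-reflexive (+-identityˡ (- x)))

  0<x⇒x≉0 : ∀ {x} → 0# < x → ¬ x ≈ 0#
  0<x⇒x≉0 (_ , 0≉x) x≈0 = 0≉x (sym x≈0)

  *-cancelˡ-≈0 : ∀ {s g} → ¬ s ≈ 0# → s * g ≈ 0# → g ≈ 0#
  *-cancelˡ-≈0 {s} {g} s≉0 sg≈0 = begin
    g                ≈⟨ *-identityˡ g ⟨
    1# * g           ≈⟨ *-congʳ (⁻¹-inverse s s≉0) ⟨
    s * s ⁻¹ * g     ≈⟨ solve 3 (λ s t g → s :* t :* g := t :* (s :* g)) refl s (s ⁻¹) g ⟩
    s ⁻¹ * (s * g)   ≈⟨ *-congˡ sg≈0 ⟩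
    s ⁻¹ * 0#        ≈⟨ zeroʳ (s ⁻¹) ⟩
    0#               ∎
    where open ≈-Reasoning

  *-cancelˡ-nonNeg : ∀ {s g} → 0# < s → 0# ≤ s * g → 0# ≤ g
  *-cancelˡ-nonNeg {s} {g} 0<s 0≤sg with total 0# g
  ... | inj₁ 0≤g = 0≤g
  ... | inj₂ g≤0 = ≤-reflexive (sym (*-cancelˡ-≈0 (0<x⇒x≉0 0<s) (antisym sg≤0 0≤sg)))
    where
    0≤-g : 0# ≤ - g
    0≤-g = ≤-trans (x≤y⇒0≤y-x g≤0) (≤-reflexive (+-identityˡ (- g)))
    sg≤0 : s * g ≤ 0#
    sg≤0 = 0≤y-x⇒x≤y (≤-trans (*-nonneg (proj₁ 0<s) 0≤-g)
             (≤-reflexive (solve 2 (λ s g → s :* :- g := con (+ 0) :- s :* g) refl s g)))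

  pos+nonNeg⇒pos : ∀ {x y} → 0# < x → 0# ≤ y → 0# < x + y
  pos+nonNeg⇒pos {x} (0≤x , 0≉x) 0≤y = ≤-trans 0≤x (x≤x+y x 0≤y) , λ 0≈x+y →
    0≉x (antisym 0≤x (≤-trans (x≤x+y x 0≤y) (≤-reflexive (sym 0≈x+y))))

  nonNeg+pos⇒pos : ∀ {x y} → 0# ≤ x → 0# < y → 0# < x + y
  nonNeg+pos⇒pos {x} {y} 0≤x 0<y with pos+nonNeg⇒pos 0<y 0≤x
  ... | 0≤y+x , 0≉y+x =
    ≤-trans 0≤y+x (≤-reflexive (+-comm y x)) , λ 0≈x+y → 0≉y+x (trans 0≈x+y (+-comm x y))

  pos*pos⇒pos : ∀ {x y} → 0# < x → 0# < y → 0# < x * y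
  pos*pos⇒pos 0<x (0≤y , 0≉y) = *-nonneg (proj₁ 0<x) 0≤y , λ 0≈xy →
    0≉y (sym (*-cancelˡ-≈0 (0<x⇒x≉0 0<x) (sym 0≈xy)))

  sum-mono : ∀ {n} {f g : Vector Carrier n} → (∀ i → f i ≤ g i) → sum f ≤ sum g
  sum-mono {ℕ.zero}  f≤g = ≤-refl
  sum-mono {ℕ.suc n} f≤g = +-mono-≤ (f≤g Fin.zero) (sum-mono (f≤g ∘ Fin.suc))

  ∑-distrib-diff : ∀ {n} (f g : Vector Carrier n) → sum (λ i → f i - g i) ≈ sum f - sum g
  ∑-distrib-diff f g = begin
    sum (λ i → f i - g i)         ≈⟨ ∑-distrib-+ f (λ i → - g i) ⟩
    sum f + sum (λ i → - g i)     ≈⟨ +-congˡ (sum-cong-≋ (λ i → -1*x≈-x (g i))) ⟨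
    sum f + sum (λ i → - 1# * g i) ≈⟨ +-congˡ (*-distribˡ-sum (- 1#) g) ⟨
    sum f + - 1# * sum g          ≈⟨ +-congˡ (-1*x≈-x (sum g)) ⟩
    sum f - sum g                 ∎
    where open ≈-Reasoning

module MergeCost {c ℓ} (F : OrderedField c ℓ) where
  open OrderedField F
  open OrderedFieldProperties F
  open IntegerCoefficientSolver commutativeRing
  open Geometry F using (four)

  -- Clusters of weights a, b, centroids α, β and scatters tA, tB merge into one
  -- of centroid m and scatter t at cost a b (α − β)² / (a + b).
  merge-identity : ∀ {a b α β m t tA tB} →
    (a + b) * m ≈ a * α + b * β →
    t + (a + b) * (m * m) ≈ (tA + a * (α * α)) + (tB + b * (β * β)) →
    (a + b) * (t - tA - tB) ≈ a * b * ((α - β) * (α - β))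
  merge-identity {a} {b} {α} {β} {m} {t} {tA} {tB} centroid moment = begin
    (a + b) * (t - tA - tB)
      ≈⟨ solve 6 (λ a b m t tA tB →
           (a :+ b) :* (t :- tA :- tB)
             := (a :+ b) :* (t :+ (a :+ b) :* (m :* m)) :- (a :+ b) :* (tA :+ tB)
                  :- ((a :+ b) :* m) :* ((a :+ b) :* m)) refl a b m t tA tB ⟩
    (a + b) * (t + (a + b) * (m * m)) - (a + b) * (tA + tB) - ((a + b) * m) * ((a + b) * m)
      ≈⟨ +-cong (+-congʳ (*-congˡ moment)) (-‿cong (*-cong centroid centroid)) ⟩
    (a + b) * ((tA + a * (α * α)) + (tB + b * (β * β))) - (a + b) * (tA + tB)
      - (a * α + b * β) * (a * α + b * β)
      ≈⟨ solve 6 (λ a b α β tA tB →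
           (a :+ b) :* ((tA :+ a :* (α :* α)) :+ (tB :+ b :* (β :* β))) :- (a :+ b) :* (tA :+ tB)
             :- (a :* α :+ b :* β) :* (a :* α :+ b :* β)
             := a :* b :* ((α :- β) :* (α :- β))) refl a b α β tA tB ⟩
    a * b * ((α - β) * (α - β)) ∎
    where open ≈-Reasoning

  cost-gap-certificate : (a b c α β γ : Carrier) → Carrier
  cost-gap-certificate a b c α β γ =
    a * V * ((U * p - c * q) * (U * p - c * q)) + two * a * U * k * (p * p) + two * V * c * k * (q * q)
    where
    U = b + c
    V = a + b
    p = α - β
    q = β - γ
    k = a * b + b * b + c * (b - a)

  -- The coefficient k = ab + b² + c(b − a) is where a ≤ b is needed.
  cost-gap-certificate-nonNeg : ∀ {a b c} α β γ → 0# ≤ a → 0# ≤ b → 0# ≤ c → a ≤ b →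
    0# ≤ cost-gap-certificate a b c α β γ
  cost-gap-certificate-nonNeg {a} {b} {c} α β γ 0≤a 0≤b 0≤c a≤b =
    nonNeg+nonNeg⇒nonNeg
      (nonNeg+nonNeg⇒nonNeg (*-nonneg (*-nonneg 0≤a 0≤V) (0≤x*x _))
        (*-nonneg (*-nonneg (*-nonneg (*-nonneg 0≤two 0≤a) 0≤U) 0≤k) (0≤x*x (α - β))))
      (*-nonneg (*-nonneg (*-nonneg (*-nonneg 0≤two 0≤V) 0≤c) 0≤k) (0≤x*x (β - γ)))
    where
    0≤U = nonNeg+nonNeg⇒nonNeg 0≤b 0≤c
    0≤V = nonNeg+nonNeg⇒nonNeg 0≤a 0≤b
    0≤k = nonNeg+nonNeg⇒nonNeg (nonNeg+nonNeg⇒nonNeg (*-nonneg 0≤a 0≤b) (*-nonneg 0≤b 0≤b))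
            (*-nonneg 0≤c (x≤y⇒0≤y-x a≤b))
    0≤two = nonNeg+nonNeg⇒nonNeg 0≤1 0≤1
      where
      0≤1 : 0# ≤ 1#
      0≤1 = ≤-trans (0≤x*x 1#) (≤-reflexive (*-identityˡ 1#))

  -- x, y, z stand for the merge costs of (A, B ∪ C), (B, C) and (A, B), and n
  -- for the centroid of B ∪ C.
  scaled-cost-gap : ∀ {a b c α β γ n x y z} →
    (b + c) * n ≈ b * β + c * γ →
    (a + (b + c)) * x ≈ a * (b + c) * ((α - n) * (α - n)) →
    (b + c) * y ≈ b * c * ((β - γ) * (β - γ)) →
    (a + b) * z ≈ a * b * ((α - β) * (α - β)) →
    (a + (b + c)) * (b + c) * (a + b) * (two * y + four * z - x) ≈ cost-gap-certificate a b c α β γ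
  scaled-cost-gap {a} {b} {c} {α} {β} {γ} {n} {x} {y} {z} centroid cost-a-bc cost-bc cost-ab = begin
    S * U * V * (two * y + four * z - x)
      ≈⟨ solve 6 (λ a b c x y z →
           (a :+ (b :+ c)) :* (b :+ c) :* (a :+ b) :* (con (+ 2) :* y :+ con (+ 4) :* z :- x)
             := con (+ 2) :* ((a :+ (b :+ c)) :* (a :+ b)) :* ((b :+ c) :* y)
                :+ con (+ 4) :* ((a :+ (b :+ c)) :* (b :+ c)) :* ((a :+ b) :* z)
                :- ((b :+ c) :* (a :+ b)) :* ((a :+ (b :+ c)) :* x)) refl a b c x y z ⟩
    two * (S * V) * (U * y) + four * (S * U) * (V * z) - (U * V) * (S * x)
      ≈⟨ +-cong (+-cong (*-congˡ cost-bc) (*-congˡ cost-ab)) (-‿cong (*-congˡ cost-a-bc)) ⟩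
    two * (S * V) * (b * c * (q * q)) + four * (S * U) * (a * b * (p * p))
      - (U * V) * (a * U * ((α - n) * (α - n)))
      ≈⟨ +-congˡ (-‿cong (solve 5 (λ a b c α n →
           ((b :+ c) :* (a :+ b)) :* (a :* (b :+ c) :* ((α :- n) :* (α :- n)))
             := a :* (a :+ b) :* (((b :+ c) :* α :- (b :+ c) :* n) :* ((b :+ c) :* α :- (b :+ c) :* n)))
           refl a b c α n)) ⟩
    two * (S * V) * (b * c * (q * q)) + four * (S * U) * (a * b * (p * p))
      - a * V * ((U * α - U * n) * (U * α - U * n))
      ≈⟨ +-congˡ (-‿cong (*-congˡ (*-cong (+-congˡ (-‿cong centroid)) (+-congˡ (-‿cong centroid))))) ⟩
    two * (S * V) * (b * c * (q * q)) + four * (S * U) * (a * b * (p * p))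
      - a * V * ((U * α - (b * β + c * γ)) * (U * α - (b * β + c * γ)))
      ≈⟨ solve 6 (λ a b c α β γ →
           con (+ 2) :* ((a :+ (b :+ c)) :* (a :+ b)) :* (b :* c :* ((β :- γ) :* (β :- γ)))
             :+ con (+ 4) :* ((a :+ (b :+ c)) :* (b :+ c)) :* (a :* b :* ((α :- β) :* (α :- β)))
             :- a :* (a :+ b) :* (((b :+ c) :* α :- (b :* β :+ c :* γ)) :* ((b :+ c) :* α :- (b :* β :+ c :* γ)))
           := a :* (a :+ b) :* (((b :+ c) :* (α :- β) :- c :* (β :- γ)) :* ((b :+ c) :* (α :- β) :- c :* (β :- γ)))
             :+ con (+ 2) :* a :* (b :+ c) :* (a :* b :+ b :* b :+ c :* (b :- a)) :* ((α :- β) :* (α :- β))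
             :+ con (+ 2) :* (a :+ b) :* c :* (a :* b :+ b :* b :+ c :* (b :- a)) :* ((β :- γ) :* (β :- γ)))
           refl a b c α β γ ⟩
    cost-gap-certificate a b c α β γ ∎
    where
    open ≈-Reasoning
    S = a + (b + c)
    U = b + c
    V = a + b
    p = α - β
    q = β - γ

  merge-cost-bound : ∀ {a b c α β γ n x y z} →
    0# ≤ a → 0# < b → 0# ≤ c → a ≤ b →
    (b + c) * n ≈ b * β + c * γ →
    (a + (b + c)) * x ≈ a * (b + c) * ((α - n) * (α - n)) →
    (b + c) * y ≈ b * c * ((β - γ) * (β - γ)) →
    (a + b) * z ≈ a * b * ((α - β) * (α - β)) →
    x ≤ two * y + four * z
  merge-cost-bound {α = α} {β} {γ} 0≤a 0<b 0≤c a≤b centroid cost-a-bc cost-bc cost-ab =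
    0≤y-x⇒x≤y (*-cancelˡ-nonNeg 0<SUV
      (≤-trans (cost-gap-certificate-nonNeg α β γ 0≤a (proj₁ 0<b) 0≤c a≤b)
        (≤-reflexive (sym (scaled-cost-gap centroid cost-a-bc cost-bc cost-ab)))))
    where
    0<U = pos+nonNeg⇒pos 0<b 0≤c
    0<SUV = pos*pos⇒pos (pos*pos⇒pos (nonNeg+pos⇒pos 0≤a 0<U) 0<U) (nonNeg+pos⇒pos 0≤a 0<b)

module Clustering {c ℓ} (F : OrderedField c ℓ) (d : ℕ)
  (w : Geometry.Point F d → OrderedField.Carrier F) where
  open OrderedField F
  open OrderedFieldProperties F
  open MergeCost F
  open Geometry F
  open Weighted w
  open IntegerCoefficientSolver commutativeRing
  open import Algebra.Properties.Semiring.Sum semiring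
    using (sum; ∑-distrib-+; *-distribˡ-sum; sum-replicate-zero)

  Positive : List (Point d) → Set _
  Positive Q = ∀ x → x ∈ₚ Q → 0# < w x

  ∈ₚ-head : ∀ (x : Point d) {Q} → x ∈ₚ (x ∷ Q)
  ∈ₚ-head x = here (λ _ → refl)

  sumL-++ : ∀ (f : Point d → Carrier) P Q → sumL (map f (P ++ Q)) ≈ sumL (map f P) + sumL (map f Q)
  sumL-++ f []      Q = sym (+-identityˡ _)
  sumL-++ f (x ∷ P) Q = trans (+-congˡ (sumL-++ f P Q)) (sym (+-assoc _ _ _))

  sumL-nonNeg : ∀ {f : Point d → Carrier} Q → (∀ x → x ∈ₚ Q → 0# ≤ f x) → 0# ≤ sumL (map f Q)
  sumL-nonNeg []      _   = ≤-refl
  sumL-nonNeg (x ∷ Q) f≥0 =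
    nonNeg+nonNeg⇒nonNeg (f≥0 x (∈ₚ-head x)) (sumL-nonNeg Q (λ y y∈Q → f≥0 y (there y∈Q)))

  sumL-∑-swap : ∀ (f : Point d → Fin d → Carrier) Q →
    sumL (map (λ x → w x * sum (f x)) Q) ≈ sum (λ i → sumL (map (λ x → w x * f x i) Q))
  sumL-∑-swap f []      = sym (sum-replicate-zero d)
  sumL-∑-swap f (x ∷ Q) = trans (+-cong (*-distribˡ-sum (w x) (f x)) (sumL-∑-swap f Q))
    (sym (∑-distrib-+ (λ i → w x * f x i) (λ i → sumL (map (λ y → w y * f y i) Q))))

  wt-++ : ∀ P Q → wt (P ++ Q) ≈ wt P + wt Q
  wt-++ = sumL-++ w

  wt-pos : ∀ {Q} → Q ≢ [] → Positive Q → 0# < wt Q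
  wt-pos {[]}    Q≢[] _     = ⊥-elim (Q≢[] ≡-refl)
  wt-pos {x ∷ Q} _    w>0 =
    pos+nonNeg⇒pos (w>0 x (∈ₚ-head x)) (sumL-nonNeg Q (λ y y∈Q → proj₁ (w>0 y (there y∈Q))))

  wt-++-pos : ∀ P Q → 0# < wt P → 0# < wt Q → 0# < wt (P ++ Q)
  wt-++-pos P Q 0<wtP 0<wtQ with pos+nonNeg⇒pos 0<wtP (proj₁ 0<wtQ)
  ... | 0≤sum , 0≉sum = ≤-trans 0≤sum (≤-reflexive (sym (wt-++ P Q))) ,
                        λ 0≈wt → 0≉sum (trans 0≈wt (wt-++ P Q))

  Δ-nonNeg : ∀ {Q} → Positive Q → 0# ≤ Δ Q
  Δ-nonNeg {Q} w>0 = sumL-nonNeg Q (λ x x∈Q → *-nonneg (proj₁ (w>0 x x∈Q)) (‖‖²-nonNeg (x -ₚ μ Q)))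
    where
    ‖‖²-nonNeg : (v : Point d) → 0# ≤ ‖ v ‖²
    ‖‖²-nonNeg v = ≤-trans (≤-reflexive (sym (sum-replicate-zero d)))
                     (sum-mono (λ i → 0≤x*x (v i)))

  moment₁ : List (Point d) → Fin d → Carrier
  moment₁ Q i = sumL (map (λ x → w x * x i) Q)

  moment₂ : List (Point d) → Fin d → Carrier
  moment₂ Q i = sumL (map (λ x → w x * (x i * x i)) Q)

  scatter : List (Point d) → Fin d → Carrier → Carrier
  scatter Q i m = sumL (map (λ x → w x * ((x i - m) * (x i - m))) Q)

  Δᵢ : List (Point d) → Fin d → Carrier
  Δᵢ Q i = scatter Q i (μ Q i)

  Dᵢ : List (Point d) → List (Point d) → Fin d → Carrier
  Dᵢ P Q i = Δᵢ (P ++ Q) i - Δᵢ P i - Δᵢ Q i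

  Δ≈∑Δᵢ : ∀ Q → Δ Q ≈ sum (Δᵢ Q)
  Δ≈∑Δᵢ Q = sumL-∑-swap (λ x i → (x i - μ Q i) * (x i - μ Q i)) Q

  D≈∑Dᵢ : ∀ P Q → D P Q ≈ sum (Dᵢ P Q)
  D≈∑Dᵢ P Q = begin
    Δ (P ++ Q) - Δ P - Δ Q
      ≈⟨ +-cong (+-cong (Δ≈∑Δᵢ (P ++ Q)) (-‿cong (Δ≈∑Δᵢ P))) (-‿cong (Δ≈∑Δᵢ Q)) ⟩
    sum (Δᵢ (P ++ Q)) - sum (Δᵢ P) - sum (Δᵢ Q)
      ≈⟨ +-congʳ (∑-distrib-diff (Δᵢ (P ++ Q)) (Δᵢ P)) ⟨
    sum (λ i → Δᵢ (P ++ Q) i - Δᵢ P i) - sum (Δᵢ Q)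
      ≈⟨ ∑-distrib-diff (λ i → Δᵢ (P ++ Q) i - Δᵢ P i) (Δᵢ Q) ⟨
    sum (Dᵢ P Q) ∎
    where open ≈-Reasoning

  scatter-expand : ∀ Q i m → scatter Q i m ≈ moment₂ Q i - two * m * moment₁ Q i + wt Q * (m * m)
  scatter-expand []      i m = solve 1 (λ m →
    con (+ 0) := con (+ 0) :- con (+ 2) :* m :* con (+ 0) :+ con (+ 0) :* (m :* m)) refl m
  scatter-expand (x ∷ Q) i m = trans (+-congˡ (scatter-expand Q i m)) (cons (w x) (x i) m _ _ _)
    where
    cons : ∀ v xᵢ m M₂ M₁ W →
      v * ((xᵢ - m) * (xᵢ - m)) + (M₂ - two * m * M₁ + W * (m * m))
        ≈ (v * (xᵢ * xᵢ) + M₂) - two * m * (v * xᵢ + M₁) + (v + W) * (m * m)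
    cons = solve 6 (λ v xᵢ m M₂ M₁ W →
      v :* ((xᵢ :- m) :* (xᵢ :- m)) :+ (M₂ :- con (+ 2) :* m :* M₁ :+ W :* (m :* m))
        := (v :* (xᵢ :* xᵢ) :+ M₂) :- con (+ 2) :* m :* (v :* xᵢ :+ M₁) :+ (v :+ W) :* (m :* m)) refl

  wt*μ≈moment₁ : ∀ Q i → 0# < wt Q → wt Q * μ Q i ≈ moment₁ Q i
  wt*μ≈moment₁ Q i 0<wtQ = begin
    wt Q * (wt Q ⁻¹ * moment₁ Q i)  ≈⟨ *-assoc _ _ _ ⟨
    wt Q * wt Q ⁻¹ * moment₁ Q i    ≈⟨ *-congʳ (⁻¹-inverse (wt Q) (0<x⇒x≉0 0<wtQ)) ⟩
    1# * moment₁ Q i                ≈⟨ *-identityˡ _ ⟩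
    moment₁ Q i                     ∎
    where open ≈-Reasoning

  Δᵢ+wt*μ²≈moment₂ : ∀ Q i → 0# < wt Q → Δᵢ Q i + wt Q * (μ Q i * μ Q i) ≈ moment₂ Q i
  Δᵢ+wt*μ²≈moment₂ Q i 0<wtQ = begin
    Δᵢ Q i + W * (m * m)
      ≈⟨ +-congʳ (scatter-expand Q i m) ⟩
    M₂ - two * m * moment₁ Q i + W * (m * m) + W * (m * m)
      ≈⟨ +-congʳ (+-congʳ (+-congˡ (-‿cong (*-congˡ (wt*μ≈moment₁ Q i 0<wtQ))))) ⟨
    M₂ - two * m * (W * m) + W * (m * m) + W * (m * m)
      ≈⟨ solve 3 (λ M₂ m W →
           M₂ :- con (+ 2) :* m :* (W :* m) :+ W :* (m :* m) :+ W :* (m :* m) := M₂) refl M₂ m W ⟩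
    M₂ ∎
    where
    open ≈-Reasoning
    W = wt Q
    m = μ Q i
    M₂ = moment₂ Q i

  μ-++ : ∀ P Q i → 0# < wt P → 0# < wt Q →
    (wt P + wt Q) * μ (P ++ Q) i ≈ wt P * μ P i + wt Q * μ Q i
  μ-++ P Q i 0<wtP 0<wtQ = begin
    (wt P + wt Q) * μ (P ++ Q) i  ≈⟨ *-congʳ (wt-++ P Q) ⟨
    wt (P ++ Q) * μ (P ++ Q) i    ≈⟨ wt*μ≈moment₁ (P ++ Q) i (wt-++-pos P Q 0<wtP 0<wtQ) ⟩
    moment₁ (P ++ Q) i            ≈⟨ sumL-++ (λ x → w x * x i) P Q ⟩
    moment₁ P i + moment₁ Q i     ≈⟨ +-cong (wt*μ≈moment₁ P i 0<wtP) (wt*μ≈moment₁ Q i 0<wtQ) ⟨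
    wt P * μ P i + wt Q * μ Q i   ∎
    where open ≈-Reasoning

  Δᵢ-++ : ∀ P Q i → 0# < wt P → 0# < wt Q →
    Δᵢ (P ++ Q) i + (wt P + wt Q) * (μ (P ++ Q) i * μ (P ++ Q) i)
      ≈ (Δᵢ P i + wt P * (μ P i * μ P i)) + (Δᵢ Q i + wt Q * (μ Q i * μ Q i))
  Δᵢ-++ P Q i 0<wtP 0<wtQ = begin
    Δᵢ (P ++ Q) i + (wt P + wt Q) * (μ (P ++ Q) i * μ (P ++ Q) i)
      ≈⟨ +-congˡ (*-congʳ (wt-++ P Q)) ⟨
    Δᵢ (P ++ Q) i + wt (P ++ Q) * (μ (P ++ Q) i * μ (P ++ Q) i)
      ≈⟨ Δᵢ+wt*μ²≈moment₂ (P ++ Q) i (wt-++-pos P Q 0<wtP 0<wtQ) ⟩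
    moment₂ (P ++ Q) i
      ≈⟨ sumL-++ (λ x → w x * (x i * x i)) P Q ⟩
    moment₂ P i + moment₂ Q i
      ≈⟨ +-cong (Δᵢ+wt*μ²≈moment₂ P i 0<wtP) (Δᵢ+wt*μ²≈moment₂ Q i 0<wtQ) ⟨
    (Δᵢ P i + wt P * (μ P i * μ P i)) + (Δᵢ Q i + wt Q * (μ Q i * μ Q i)) ∎
    where open ≈-Reasoning

  Dᵢ-centroids : ∀ P Q i → 0# < wt P → 0# < wt Q →
    (wt P + wt Q) * Dᵢ P Q i ≈ wt P * wt Q * ((μ P i - μ Q i) * (μ P i - μ Q i))
  Dᵢ-centroids P Q i 0<wtP 0<wtQ = merge-identity (μ-++ P Q i 0<wtP 0<wtQ) (Δᵢ-++ P Q i 0<wtP 0<wtQ)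

  Dᵢ-bound : ∀ A B C i → 0# < wt A → 0# < wt B → 0# < wt C → wt A ≤ wt B →
    Dᵢ A (B ++ C) i ≤ two * Dᵢ B C i + four * Dᵢ A B i
  Dᵢ-bound A B C i 0<wtA 0<wtB 0<wtC wtA≤wtB =
    merge-cost-bound (proj₁ 0<wtA) 0<wtB (proj₁ 0<wtC) wtA≤wtB
      (μ-++ B C i 0<wtB 0<wtC) cost-A-BC (Dᵢ-centroids B C i 0<wtB 0<wtC) (Dᵢ-centroids A B i 0<wtA 0<wtB)
    where
    cost-A-BC : (wt A + (wt B + wt C)) * Dᵢ A (B ++ C) i
                  ≈ wt A * (wt B + wt C) * ((μ A i - μ (B ++ C) i) * (μ A i - μ (B ++ C) i))
    cost-A-BC = trans (*-congʳ (+-congˡ (sym (wt-++ B C))))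
                  (trans (Dᵢ-centroids A (B ++ C) i 0<wtA (wt-++-pos B C 0<wtB 0<wtC))
                    (*-congʳ (*-congˡ (wt-++ B C))))

  D-bound : ∀ A B C → 0# < wt A → 0# < wt B → 0# < wt C → wt A ≤ wt B →
    D A (B ++ C) ≤ two * D B C + four * D A B
  D-bound A B C 0<wtA 0<wtB 0<wtC wtA≤wtB = begin
    D A (B ++ C)
      ≈⟨ D≈∑Dᵢ A (B ++ C) ⟩
    sum (Dᵢ A (B ++ C))
      ≤⟨ sum-mono (λ i → Dᵢ-bound A B C i 0<wtA 0<wtB 0<wtC wtA≤wtB) ⟩
    sum (λ i → two * Dᵢ B C i + four * Dᵢ A B i)
      ≈⟨ ∑-distrib-+ (λ i → two * Dᵢ B C i) (λ i → four * Dᵢ A B i) ⟩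
    sum (λ i → two * Dᵢ B C i) + sum (λ i → four * Dᵢ A B i)
      ≈⟨ +-cong (*-distribˡ-sum two (Dᵢ B C)) (*-distribˡ-sum four (Dᵢ A B)) ⟨
    two * sum (Dᵢ B C) + four * sum (Dᵢ A B)
      ≈⟨ +-cong (*-congˡ (D≈∑Dᵢ B C)) (*-congˡ (D≈∑Dᵢ A B)) ⟨
    two * D B C + four * D A B ∎
    where open ≤-Reasoning

  Δ-bound : ∀ A B C → 0# ≤ Δ B → 0# ≤ Δ C → D A (B ++ C) ≤ two * D B C + four * D A B →
    Δ (A ++ B ++ C) ≤ Δ A + three * Δ (B ++ C) + four * D A B
  Δ-bound A B C 0≤ΔB 0≤ΔC cost-bound = begin
    Δ (A ++ B ++ C)
      ≈⟨ solve 3 (λ t a u → t := a :+ u :+ (t :- a :- u)) refl (Δ (A ++ B ++ C)) (Δ A) (Δ (B ++ C)) ⟩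
    Δ A + Δ (B ++ C) + D A (B ++ C)
      ≤⟨ +-monoʳ-≤ (Δ A + Δ (B ++ C)) cost-bound ⟩
    Δ A + Δ (B ++ C) + (two * D B C + four * D A B)
      ≤⟨ x≤x+y _ (nonNeg+nonNeg⇒nonNeg 0≤ΔB+ΔC 0≤ΔB+ΔC) ⟩
    Δ A + Δ (B ++ C) + (two * D B C + four * D A B) + ((Δ B + Δ C) + (Δ B + Δ C))
      ≈⟨ solve 5 (λ a u b c z →
           a :+ u :+ (con (+ 2) :* (u :- b :- c) :+ con (+ 4) :* z) :+ ((b :+ c) :+ (b :+ c))
             := a :+ con (+ 3) :* u :+ con (+ 4) :* z) refl (Δ A) (Δ (B ++ C)) (Δ B) (Δ C) (D A B) ⟩
    Δ A + three * Δ (B ++ C) + four * D A B ∎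
    where
    open ≤-Reasoning
    0≤ΔB+ΔC = nonNeg+nonNeg⇒nonNeg 0≤ΔB 0≤ΔC

  D-++-bound : ∀ A B C → Δ (A ++ B ++ C) ≤ Δ A + three * Δ (B ++ C) + four * D A B →
    D (A ++ B) C ≤ three * Δ (B ++ C) + three * D A B - Δ B - Δ C
  D-++-bound A B C Δ-ABC-bound = begin
    Δ ((A ++ B) ++ C) - Δ (A ++ B) - Δ C
      ≡⟨ cong (λ Q → Δ Q - Δ (A ++ B) - Δ C) (++-assoc A B C) ⟩
    Δ (A ++ B ++ C) - Δ (A ++ B) - Δ C
      ≤⟨ +-monoˡ-≤ (- Δ C) (+-monoˡ-≤ (- Δ (A ++ B)) Δ-ABC-bound) ⟩
    Δ A + three * Δ (B ++ C) + four * D A B - Δ (A ++ B) - Δ C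
      ≈⟨ solve 5 (λ a u s b c →
           a :+ con (+ 3) :* u :+ con (+ 4) :* (s :- a :- b) :- s :- c
             := con (+ 3) :* u :+ con (+ 3) :* (s :- a :- b) :- b :- c)
           refl (Δ A) (Δ (B ++ C)) (Δ (A ++ B)) (Δ B) (Δ C) ⟩
    three * Δ (B ++ C) + three * D A B - Δ B - Δ C ∎
    where open ≤-Reasoning

corollary5 : ∀ {c ℓ : Level} (F : OrderedField c ℓ) (d : ℕ)
    → let open OrderedField F
          open Geometry F
      in (w : Point d → Carrier) (A B C : List (Point d))
    → A ≢ [] → B ≢ [] → C ≢ []
    → Distinct A → Distinct B → Distinct C
    → Disjoint A B → Disjoint A C → Disjoint B C
    → (∀ x → x ∈ₚ (A ++ B ++ C) → 0# < w x)
    → let open Weighted w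
      in wt A ≤ wt B
    → (Δ (A ++ B ++ C) ≤ Δ A + three * Δ (B ++ C) + four * D A B)
      × (D (A ++ B) C ≤ three * Δ (B ++ C) + three * D A B - Δ B - Δ C)
corollary5 F d w A B C A≢[] B≢[] C≢[] _ _ _ _ _ _ w>0 wtA≤wtB =
  Δ-ABC-bound , D-++-bound A B C Δ-ABC-bound
  where
  open OrderedField F
  open Geometry F
  open Weighted w
  open Clustering F d w
  positiveA : Positive A
  positiveA x x∈A = w>0 x (++⁺ˡ x∈A)
  positiveB : Positive B
  positiveB x x∈B = w>0 x (++⁺ʳ A (++⁺ˡ x∈B))
  positiveC : Positive C
  positiveC x x∈C = w>0 x (++⁺ʳ A (++⁺ʳ B x∈C))
  Δ-ABC-bound : Δ (A ++ B ++ C) ≤ Δ A + three * Δ (B ++ C) + four * D A B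
  Δ-ABC-bound = Δ-bound A B C (Δ-nonNeg positiveB) (Δ-nonNeg positiveC)
    (D-bound A B C (wt-pos A≢[] positiveA) (wt-pos B≢[] positiveB) (wt-pos C≢[] positiveC) wtA≤wtB)
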